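{- Let $G$ be a monochromatic complete bipartite graph $K_{m,n}$ with $m\ge n\ge 2$ and $m+n\ge 9$. If $n\in\{2,3\}$, then $G$ is $(2,2)$-optimal feasible, and if $n\ge 4$, then $G$ is $(3,2)$-optimal feasible.
   Context: An edge-colored graph is properly colored if no two adjacent edges share a color; an edge-colored connected graph is properly connected if between every pair of distinct vertices there is a properly colored path. A monochromatic graph is one in which every edge has color $0$; any color $i\neq 0$ is a new color. For a monochromatic connected graph $G$, $pc_{opt}(G)$ is the minimum of $p+q$ over all ways to make $G$ properly connected by recoloring $p$ edges of $G$ using $q$ new colors. $G$ is $(p,q)$-feasible if $G$ can be made properly connected by recoloring $p$ edges with $q$ new colors, and $(p,q)$-optimal feasible if it is $(p,q)$-feasible and $p+q=pc_{opt}(G)$. -}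

module Defs where

open import Data.Nat using (ℕ; zero; suc; _+_; _≤_)
open import Data.Fin using (Fin)
open import Data.Sum using (_⊎_; inj₁; inj₂)
open import Data.Product using (Σ; _×_; ∃; ∃-syntax; _,_)
open import Data.Unit using (⊤)
open import Data.Empty using (⊥)
open import Data.List using (List; []; _∷_; _++_; map; allFin)
open import Data.Nat.ListAction using (sum)
open import Data.List.Relation.Unary.Unique.Propositional using (Unique)
open import Data.List.Relation.Unary.Linked using (Linked)
open import Relation.Binary.PropositionalEquality using (_≡_; _≢_)

Vertex : ℕ → ℕ → Set
Vertex m n = Fin m ⊎ Fin n

Adj : ∀ {m n} → Vertex m n → Vertex m n → Set
Adj (inj₁ _) (inj₂ _) = ⊤
Adj (inj₂ _) (inj₁ _) = ⊤
Adj (inj₁ _) (inj₁ _) = ⊥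
Adj (inj₂ _) (inj₂ _) = ⊥

-- An edge-colouring of K_{m,n}: the edge {inj₁ i , inj₂ j} gets colour c i j.
-- Colour 0 is the original colour; colours ≥ 1 are new colours.
Colouring : ℕ → ℕ → Set
Colouring m n = Fin m → Fin n → ℕ

-- colour of the edge between two vertices (value on non-adjacent pairs irrelevant)
ecol : ∀ {m n} → Colouring m n → Vertex m n → Vertex m n → ℕ
ecol c (inj₁ i) (inj₂ j) = c i j
ecol c (inj₂ j) (inj₁ i) = c i j
ecol c (inj₁ _) (inj₁ _) = 0
ecol c (inj₂ _) (inj₂ _) = 0

ProperCol : ∀ {m n} → Colouring m n → List (Vertex m n) → Set
ProperCol c (x ∷ y ∷ z ∷ rest) = (ecol c x y ≢ ecol c y z) × ProperCol c (y ∷ z ∷ rest)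
ProperCol c _ = ⊤

ProperPath : ∀ {m n} → Colouring m n → List (Vertex m n) → Set
ProperPath c xs = Unique xs × Linked Adj xs × ProperCol c xs

ProperlyConnected : ∀ {m n} → Colouring m n → Set
ProperlyConnected {m} {n} c =
  (u v : Vertex m n) → u ≢ v →
  ∃[ mid ] ProperPath c (u ∷ mid ++ (v ∷ []))

nz : ℕ → ℕ
nz zero = 0
nz (suc _) = 1

recoloured : ∀ {m n} → Colouring m n → ℕ
recoloured {m} {n} c = sum (map (λ i → sum (map (λ j → nz (c i j)) (allFin n))) (allFin m))

UsesColours : ∀ {m n} → Colouring m n → ℕ → Set
UsesColours {m} {n} c q =
  ((i : Fin m) (j : Fin n) → c i j ≤ q) ×
  ((k : ℕ) → 1 ≤ k → k ≤ q → ∃[ i ] ∃[ j ] c i j ≡ k)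

Feasible : ℕ → ℕ → ℕ → ℕ → Set
Feasible m n p q =
  Σ (Colouring m n) λ c → recoloured c ≡ p × UsesColours c q × ProperlyConnected c

IsPcOpt : ℕ → ℕ → ℕ → Set
IsPcOpt m n k =
  (∃[ p ] ∃[ q ] Feasible m n p q × p + q ≡ k) ×
  ((p q : ℕ) → Feasible m n p q → k ≤ p + q)

OptimalFeasible : ℕ → ℕ → ℕ → ℕ → Set
OptimalFeasible m n p q = Feasible m n p q × IsPcOpt m n (p + q)

module Submission where

-- Upper bounds: colour a₀b₀ ↦ 1, a₀b₁ ↦ 2 (and a₁b₁ ↦ 1 when n ≥ 4); A-vertices
-- are joined through b₀, a₀, b₁, and B-vertices through a₀ (or a₀, b₁, a₁).
-- Lower bounds: a fork (an A-vertex with two incident edges of distinct new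
-- colours) costs two recoloured edges and two new colours.  By the walk lemma
-- a proper path between two uncoloured A-vertices passes a fork, so either a
-- fork exists or at least m - 1 ≥ 4 rows contain recoloured edges.  For n ≥ 4
-- a fork forces a third recoloured edge: otherwise two further columns are
-- uncoloured and the walk lemma for the transposed colouring gives a column
-- fork, one of whose edges lies off the first fork's row.

open import Defs
open import Data.Nat using (ℕ; zero; suc; _+_; _≤_; _<_; z≤n; s≤s; _≟_; _≤?_)
open import Data.Nat.Properties
  using (≤-refl; ≤-trans; ≤-pred; ≰⇒>; 1+n≰n; n≤1+n; n≤0⇒n≡0; n≢0⇒n>0; +-suc; m≤m+n;
         +-mono-≤; +-monoʳ-≤; +-commutativeSemigroup; module ≤-Reasoning)
open import Algebra.Properties.CommutativeSemigroup +-commutativeSemigroup using (x∙yz≈y∙xz)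
open import Data.Fin using (Fin; zero; suc)
open import Data.Fin.Properties using (any?; all?; ¬∀⟶∃¬; pigeonhole; <⇒≢; suc-injective)
import Data.Fin.Properties as Fin
open import Data.List using (List; []; _∷_; _++_; [_]; map; length; allFin; tabulate)
open import Data.List.Properties using (map-tabulate; tabulate-cong; map-++)
open import Data.Nat.ListAction using (sum)
open import Data.List.Relation.Unary.All using (All; []; _∷_)
open import Data.List.Relation.Unary.All.Properties using (¬Any⇒All¬)
open import Data.List.Relation.Unary.AllPairs using ([]; _∷_)
open import Data.List.Relation.Unary.Any using (index)
open import Data.List.Relation.Unary.Linked using (Linked; []; [-]; _∷_)
import Data.List.Relation.Unary.Linked as Linked
open import Data.List.Relation.Unary.Linked.Properties using (map⁺)
open import Data.List.Relation.Unary.Unique.Propositional using (Unique)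
open import Data.List.Membership.Propositional using (_∈_)
import Data.List.Membership.DecPropositional as DecMembership
open import Data.List.Membership.Setoid.Properties using (index-injective)
open import Data.Product using (_×_; ∃-syntax; _,_)
open import Data.Sum using (_⊎_; inj₁; inj₂; swap)
open import Data.Sum.Properties using (inj₁-injective; inj₂-injective)
open import Data.Unit using (tt)
open import Data.Empty using (⊥-elim)
open import Function using (_∘_; id; flip)
open import Relation.Nullary using (Dec; yes; no; contradiction; ¬?)
open import Relation.Nullary.Decidable using (decidable-stable)
open import Relation.Binary.PropositionalEquality
  using (_≡_; _≢_; refl; sym; trans; cong; cong₂; subst; subst₂; setoid; module ≡-Reasoning)

-- Σt f = f 0 + f 1 + … + f (k-1); unlike 'sum (map f (allFin k))' it
-- unfolds one term at a time.
Σt : ∀ {k} → (Fin k → ℕ) → ℕ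
Σt f = sum (tabulate f)

Σt-allFin : ∀ {k} (f : Fin k → ℕ) → sum (map f (allFin k)) ≡ Σt f
Σt-allFin f = cong sum (map-tabulate id f)

Σt-cong : ∀ {k} {f g : Fin k → ℕ} → (∀ i → f i ≡ g i) → Σt f ≡ Σt g
Σt-cong f≗g = cong sum (tabulate-cong f≗g)

Σt-zero : ∀ {k} (f : Fin k → ℕ) → (∀ i → f i ≡ 0) → Σt f ≡ 0
Σt-zero {zero}  f f≗0 = refl
Σt-zero {suc k} f f≗0 = cong₂ _+_ (f≗0 zero) (Σt-zero (f ∘ suc) (f≗0 ∘ suc))

erase : ∀ {k} → (Fin k → ℕ) → Fin k → Fin k → ℕ
erase f zero    zero    = 0
erase f zero    (suc y) = f (suc y)
erase f (suc x) zero    = f zero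
erase f (suc x) (suc y) = erase (f ∘ suc) x y

Σt-erase : ∀ {k} (f : Fin k → ℕ) x → Σt f ≡ f x + Σt (erase f x)
Σt-erase f zero    = refl
Σt-erase f (suc x) = begin
  f zero + Σt (f ∘ suc)                           ≡⟨ cong (f zero +_) (Σt-erase (f ∘ suc) x) ⟩
  f zero + (f (suc x) + Σt (erase (f ∘ suc) x))   ≡⟨ x∙yz≈y∙xz (f zero) (f (suc x)) _ ⟩
  f (suc x) + (f zero + Σt (erase (f ∘ suc) x))   ∎
  where open ≡-Reasoning

erase-other : ∀ {k} (f : Fin k → ℕ) x y → x ≢ y → erase f x y ≡ f y
erase-other f zero    zero    x≢y = ⊥-elim (x≢y refl)
erase-other f zero    (suc y) _   = refl
erase-other f (suc x) zero    _   = refl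
erase-other f (suc x) (suc y) x≢y = erase-other (f ∘ suc) x y (x≢y ∘ cong suc)

Σt-sub : ∀ {k} (f : Fin k → ℕ) {xs : List (Fin k)} → Unique xs → sum (map f xs) ≤ Σt f
Σt-sub f []                       = z≤n
Σt-sub f {x ∷ xs} (x∉xs ∷ unique) = begin
  f x + sum (map f xs)            ≡⟨ cong (f x +_) (sym (sum-erase x∉xs)) ⟩
  f x + sum (map (erase f x) xs)  ≤⟨ +-monoʳ-≤ (f x) (Σt-sub (erase f x) unique) ⟩
  f x + Σt (erase f x)            ≡⟨ sym (Σt-erase f x) ⟩
  Σt f                            ∎
  where
  open ≤-Reasoning
  sum-erase : ∀ {ys} → All (x ≢_) ys → sum (map (erase f x) ys) ≡ sum (map f ys)
  sum-erase []           = refl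
  sum-erase (x≢y ∷ x≢ys) = cong₂ _+_ (erase-other f x _ x≢y) (sum-erase x≢ys)

Σt-single : ∀ {k} (f : Fin k → ℕ) x → f x ≤ Σt f
Σt-single f x = ≤-trans (m≤m+n (f x) 0) (Σt-sub f ([] ∷ []))

zero-or-bound : ∀ {k} (f : Fin k → ℕ) → (∃[ i ] f i ≡ 0) ⊎ k ≤ Σt f
zero-or-bound {zero}  f = inj₂ z≤n
zero-or-bound {suc k} f with f zero ≟ 0 | zero-or-bound (f ∘ suc)
... | yes f0≡0 | _              = inj₁ (zero , f0≡0)
... | no  _    | inj₁ (i , fi≡0) = inj₁ (suc i , fi≡0)
... | no  f0≢0 | inj₂ bound     = inj₂ (+-mono-≤ (n≢0⇒n>0 f0≢0) bound)

two-zeros-or-bound : ∀ {k} (f : Fin k → ℕ) →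
  (∃[ i ] ∃[ i' ] i ≢ i' × f i ≡ 0 × f i' ≡ 0) ⊎ k ≤ suc (Σt f)
two-zeros-or-bound {zero}  f = inj₂ z≤n
two-zeros-or-bound {suc k} f with f zero ≟ 0
... | yes f0≡0 with zero-or-bound (f ∘ suc)
...   | inj₁ (i , fi≡0) = inj₁ (zero , suc i , (λ ()) , f0≡0 , fi≡0)
...   | inj₂ bound      = inj₂ (s≤s (subst (λ x → k ≤ x + Σt (f ∘ suc)) (sym f0≡0) bound))
two-zeros-or-bound {suc k} f | no f0≢0 with two-zeros-or-bound (f ∘ suc)
...   | inj₁ (i , i' , i≢i' , fi≡0 , fi'≡0) = inj₁ (suc i , suc i' , i≢i' ∘ suc-injective , fi≡0 , fi'≡0)
...   | inj₂ bound = inj₂ (subst (suc k ≤_) (+-suc (f zero) _) (+-mono-≤ (n≢0⇒n>0 f0≢0) bound))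

_∈?_ : ∀ {n} (j : Fin n) (xs : List (Fin n)) → Dec (j ∈ xs)
_∈?_ = DecMembership._∈?_ Fin._≟_

fresh : ∀ {n} (xs : List (Fin n)) → length xs < n → ∃[ j ] All (j ≢_) xs
fresh {n} xs short with any? (λ j → ¬? (j ∈? xs))
... | yes (j , j∉xs) = j , ¬Any⇒All¬ xs j∉xs
... | no  covered =
  let i , j , i<j , same = pigeonhole short (index ∘ cover)
  in  contradiction (index-injective (setoid (Fin n)) (cover i) (cover j) same) (<⇒≢ i<j)
  where
  cover : ∀ j → j ∈ xs
  cover j = decidable-stable (j ∈? xs) (λ j∉xs → covered (j , j∉xs))

rowCount : ∀ {m n} → Colouring m n → Fin m → ℕ
rowCount c i = Σt (nz ∘ c i)

recoloured≡rows : ∀ {m n} (c : Colouring m n) → recoloured c ≡ Σt (rowCount c)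
recoloured≡rows c = trans (Σt-allFin (λ i → sum (map (nz ∘ c i) (allFin _)))) (Σt-cong (λ i → Σt-allFin (nz ∘ c i)))

row≤recoloured : ∀ {m n} (c : Colouring m n) i → rowCount c i ≤ recoloured c
row≤recoloured c i = subst (rowCount c i ≤_) (sym (recoloured≡rows c)) (Σt-single (rowCount c) i)

nz-positive : ∀ {x} → x ≢ 0 → nz x ≡ 1
nz-positive {zero}  x≢0 = ⊥-elim (x≢0 refl)
nz-positive {suc x} _   = refl

nz-zero : ∀ {x} → nz x ≤ 0 → x ≡ 0
nz-zero {zero} _ = refl

row-count : ∀ {m n} (c : Colouring m n) i {js : List (Fin n)} →
  Unique js → All (λ j → c i j ≢ 0) js → length js ≤ rowCount c i
row-count c i unique nonzero = subst (_≤ rowCount c i) (count nonzero) (Σt-sub (nz ∘ c i) unique)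
  where
  count : ∀ {js} → All (λ j → c i j ≢ 0) js → sum (map (nz ∘ c i) js) ≡ length js
  count []                 = refl
  count (cij≢0 ∷ nonzero') = cong₂ _+_ (nz-positive cij≢0) (count nonzero')

RowUncoloured : ∀ {m n} → Colouring m n → Fin m → Set
RowUncoloured {n = n} c a = (j : Fin n) → c a j ≡ 0

row-uncoloured : ∀ {m n} (c : Colouring m n) a → rowCount c a ≡ 0 → RowUncoloured c a
row-uncoloured c a empty j = nz-zero (subst (nz (c a j) ≤_) empty (Σt-single (nz ∘ c a) j))

two-new-colours : ∀ {x y q} → x ≢ 0 → y ≢ 0 → x ≢ y → x ≤ q → y ≤ q → 2 ≤ q
two-new-colours {zero}        x≢0 _   _   _   _   = ⊥-elim (x≢0 refl)
two-new-colours {_} {zero}    _   y≢0 _   _   _   = ⊥-elim (y≢0 refl)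
two-new-colours {suc zero} {suc zero} _ _ x≢y _   _   = ⊥-elim (x≢y refl)
two-new-colours {suc zero} {suc (suc _)} _ _ _ _  y≤q = ≤-trans (s≤s (s≤s z≤n)) y≤q
two-new-colours {suc (suc _)} _   _   _   x≤q _   = ≤-trans (s≤s (s≤s z≤n)) x≤q

RowFork : ∀ {m n} → Colouring m n → Set
RowFork c = ∃[ r ] ∃[ b₁ ] ∃[ b₂ ] c r b₁ ≢ 0 × c r b₂ ≢ 0 × c r b₁ ≢ c r b₂

fork-colours : ∀ {m n} (c : Colouring m n) {q} → (∀ i j → c i j ≤ q) → RowFork c → 2 ≤ q
fork-colours c bounded (r , b₁ , b₂ , nz₁ , nz₂ , differ) =
  two-new-colours nz₁ nz₂ differ (bounded r b₁) (bounded r b₂)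

fork-row : ∀ {m n} (c : Colouring m n) → ((r , _) : RowFork c) → 2 ≤ rowCount c r
fork-row c (r , b₁ , b₂ , nz₁ , nz₂ , differ) =
  row-count c r ((differ ∘ cong (c r) ∷ []) ∷ [] ∷ []) (nz₁ ∷ nz₂ ∷ [])

fork-two : ∀ {m n} (c : Colouring m n) → RowFork c → 2 ≤ recoloured c
fork-two c fork@(r , _) = ≤-trans (fork-row c fork) (row≤recoloured c r)

third-edge : ∀ {m n} (c : Colouring m n) → ((r , b₁ , b₂ , _) : RowFork c) →
  ∀ {i j} → c i j ≢ 0 → i ≢ r ⊎ (b₁ ≢ j × b₂ ≢ j) → 3 ≤ recoloured c
third-edge c fork@(r , _) {i} {j} cij≢0 (inj₁ i≢r) = begin
  3                                       ≤⟨ +-mono-≤ (fork-row c fork) (+-mono-≤ other-row z≤n) ⟩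
  rowCount c r + (rowCount c i + 0)       ≤⟨ Σt-sub (rowCount c) ((i≢r ∘ sym ∷ []) ∷ [] ∷ []) ⟩
  Σt (rowCount c)                         ≡⟨ sym (recoloured≡rows c) ⟩
  recoloured c                            ∎
  where
  open ≤-Reasoning
  other-row : 1 ≤ rowCount c i
  other-row = row-count c i ([] ∷ []) (cij≢0 ∷ [])
third-edge c fork@(r , b₁ , b₂ , nz₁ , nz₂ , differ) {i} cij≢0 (inj₂ (b₁≢j , b₂≢j)) with i Fin.≟ r
... | no  i≢r = third-edge c fork cij≢0 (inj₁ i≢r)
... | yes refl = ≤-trans (row-count c i distinct (nz₁ ∷ nz₂ ∷ cij≢0 ∷ [])) (row≤recoloured c i)
  where
  distinct : Unique (b₁ ∷ b₂ ∷ _ ∷ [])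
  distinct = (differ ∘ cong (c i) ∷ b₁≢j ∷ []) ∷ (b₂≢j ∷ []) ∷ [] ∷ []

-- The walk lemma: a proper path between two uncoloured A-vertices passes a fork.

module Walk {m n} (c : Colouring m n) {v : Fin m} (v-uncoloured : RowUncoloured c v) where

  -- Follow a proper walk ending at v.  In state 'after-old' the last edge
  -- prev–b has colour 0, so the next edge b–a has a new colour (it cannot end
  -- at v, whose edges all have colour 0).  In state 'after-new' the last edge
  -- b–a has a new colour: either the next edge a–b' has colour 0 and we are
  -- back in 'after-old', or it has a new colour, which differs from the
  -- previous one, and a is a fork.
  after-old : (prev : Vertex m n) (b : Fin n) → ecol c prev (inj₂ b) ≡ 0 → ∀ mid →
    Linked Adj (prev ∷ inj₂ b ∷ mid ++ [ inj₁ v ]) →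
    ProperCol c (prev ∷ inj₂ b ∷ mid ++ [ inj₁ v ]) → RowFork c
  after-new : (b : Fin n) (a : Fin m) → c a b ≢ 0 → ∀ mid →
    Linked Adj (inj₂ b ∷ inj₁ a ∷ mid ++ [ inj₁ v ]) →
    ProperCol c (inj₂ b ∷ inj₁ a ∷ mid ++ [ inj₁ v ]) → RowFork c

  after-old prev b old []              _          (proper , _) = ⊥-elim (proper (trans old (sym (v-uncoloured b))))
  after-old prev b old (inj₂ _ ∷ mid)  (_ ∷ () ∷ _) _
  after-old prev b old (inj₁ a ∷ mid)  (_ ∷ linked) (proper , proper') =
    after-new b a (λ new≡0 → proper (trans old (sym new≡0))) mid linked proper'

  after-new b a new []               (_ ∷ () ∷ _) _
  after-new b a new (inj₁ _ ∷ mid)   (_ ∷ () ∷ _) _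
  after-new b a new (inj₂ b' ∷ mid)  (_ ∷ linked) (proper , proper') with c a b' ≟ 0
  ... | yes old = after-old (inj₁ a) b' old mid linked proper'
  ... | no  new' = a , b , b' , new , new' , proper

  fork-on-walk : ∀ {u} → RowUncoloured c u → ∀ mid →
    Linked Adj (inj₁ u ∷ mid ++ [ inj₁ v ]) → ProperCol c (inj₁ u ∷ mid ++ [ inj₁ v ]) → RowFork c
  fork-on-walk u-uncoloured []              (() ∷ _) _
  fork-on-walk u-uncoloured (inj₁ _ ∷ mid)  (() ∷ _) _
  fork-on-walk u-uncoloured (inj₂ b ∷ mid)  linked   proper = after-old _ b (u-uncoloured b) mid linked proper

open Walk using (fork-on-walk)

fork-between-rows : ∀ {m n} (c : Colouring m n) → ProperlyConnected c →
  ∀ {a a'} → a ≢ a' → RowUncoloured c a → RowUncoloured c a' → RowFork c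
fork-between-rows c connected a≢a' a-uncoloured a'-uncoloured
  with connected (inj₁ _) (inj₁ _) (a≢a' ∘ inj₁-injective)
... | mid , _ , linked , proper = fork-on-walk c a'-uncoloured a-uncoloured mid linked proper

-- Transposition exchanges the two sides; a fork of the transpose is a B-vertex
-- with two incident edges of distinct new colours.
transpose : ∀ {m n} → Colouring m n → Colouring n m
transpose = flip

ecol-transpose : ∀ {m n} (c : Colouring m n) x y → ecol (transpose c) (swap x) (swap y) ≡ ecol c x y
ecol-transpose c (inj₁ _) (inj₁ _) = refl
ecol-transpose c (inj₁ _) (inj₂ _) = refl
ecol-transpose c (inj₂ _) (inj₁ _) = refl
ecol-transpose c (inj₂ _) (inj₂ _) = refl

adj-swap : ∀ {m n} {x y : Vertex m n} → Adj x y → Adj (swap x) (swap y)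
adj-swap {x = inj₁ _} {inj₂ _} tt = tt
adj-swap {x = inj₂ _} {inj₁ _} tt = tt

properCol-transpose : ∀ {m n} (c : Colouring m n) xs → ProperCol c xs → ProperCol (transpose c) (map swap xs)
properCol-transpose c (x ∷ y ∷ z ∷ rest) (proper , proper') =
  subst₂ _≢_ (sym (ecol-transpose c x y)) (sym (ecol-transpose c y z)) proper ,
  properCol-transpose c (y ∷ z ∷ rest) proper'
properCol-transpose c []          _ = tt
properCol-transpose c (_ ∷ [])     _ = tt
properCol-transpose c (_ ∷ _ ∷ []) _ = tt

fork-between-columns : ∀ {m n} (c : Colouring m n) → ProperlyConnected c →
  ∀ {b b'} → b ≢ b' → RowUncoloured (transpose c) b → RowUncoloured (transpose c) b' → RowFork (transpose c)
fork-between-columns c connected {b} {b'} b≢b' b-uncoloured b'-uncoloured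
  with connected (inj₂ b) (inj₂ b') (b≢b' ∘ inj₂-injective)
... | mid , _ , linked , proper =
  fork-on-walk (transpose c) b'-uncoloured b-uncoloured (map swap mid)
    (subst (Linked Adj) swapped (map⁺ (Linked.map adj-swap linked)))
    (subst (ProperCol (transpose c)) swapped (properCol-transpose c _ proper))
  where
  swapped : map swap (inj₂ b ∷ mid ++ [ inj₂ b' ]) ≡ inj₁ b ∷ map swap mid ++ [ inj₁ b' ]
  swapped = cong (inj₁ b ∷_) (map-++ swap mid _)

column-test : ∀ {m n} (c : Colouring m n) j → RowUncoloured (transpose c) j ⊎ ∃[ i ] c i j ≢ 0
column-test {m} c j with all? (λ i → c i j ≟ 0)
... | yes empty = inj₁ empty
... | no  some  = inj₂ (¬∀⟶∃¬ m _ (λ i → c i j ≟ 0) some)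

module LowerBound {m n} (c : Colouring m n) (q : ℕ) (bounded : ∀ i j → c i j ≤ q)
                  (connected : ProperlyConnected c) where

  no-new-colours : q ≡ 0 → recoloured c ≡ 0
  no-new-colours refl = trans (recoloured≡rows c)
    (Σt-zero (rowCount c) (λ i → Σt-zero (nz ∘ c i) (λ j → cong nz (n≤0⇒n≡0 (bounded i j)))))

  fork-or-many : RowFork c ⊎ m ≤ suc (recoloured c)
  fork-or-many with two-zeros-or-bound (rowCount c)
  ... | inj₁ (a , a' , a≢a' , empty , empty') =
    inj₁ (fork-between-rows c connected a≢a' (row-uncoloured c a empty) (row-uncoloured c a' empty'))
  ... | inj₂ many = inj₂ (subst (λ p → m ≤ suc p) (sym (recoloured≡rows c)) many)

  many-bound : 5 ≤ m → m ≤ suc (recoloured c) → 5 ≤ recoloured c + q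
  many-bound 5≤m many = +-mono-≤ four-edges (n≢0⇒n>0 λ q≡0 → no-edges (no-new-colours q≡0))
    where
    four-edges : 4 ≤ recoloured c
    four-edges = ≤-pred (≤-trans 5≤m many)
    no-edges : recoloured c ≢ 0
    no-edges none = contradiction (subst (4 ≤_) none four-edges) λ ()

  -- When n ≥ 4 a fork forces a third recoloured edge: pick two columns j₁, j₂
  -- outside the fork; if both are uncoloured they yield a column fork, one of
  -- whose edges lies outside the row of the first fork.
  fork-three : 4 ≤ n → RowFork c → 3 ≤ recoloured c
  fork-three 4≤n fork@(r , b₁ , b₂ , _)
    with fresh (b₁ ∷ b₂ ∷ []) (≤-trans (n≤1+n 3) 4≤n)
  ... | j₁ , j₁≢b₁ ∷ j₁≢b₂ ∷ []
    with fresh (b₁ ∷ b₂ ∷ j₁ ∷ []) 4≤n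
  ... | j₂ , j₂≢b₁ ∷ j₂≢b₂ ∷ j₂≢j₁ ∷ []
    with column-test c j₁ | column-test c j₂
  ... | inj₂ (i , cij≢0) | _ = third-edge c fork cij≢0 (inj₂ (j₁≢b₁ ∘ sym , j₁≢b₂ ∘ sym))
  ... | inj₁ _ | inj₂ (i , cij≢0) = third-edge c fork cij≢0 (inj₂ (j₂≢b₁ ∘ sym , j₂≢b₂ ∘ sym))
  ... | inj₁ empty₁ | inj₁ empty₂
    with fork-between-columns c connected j₂≢j₁ empty₂ empty₁
  ... | s , a₁ , a₂ , nz₁ , nz₂ , differ with a₁ Fin.≟ r
  ...   | no  a₁≢r = third-edge c fork nz₁ (inj₁ a₁≢r)
  ...   | yes refl = third-edge c fork nz₂ (inj₁ λ a₂≡a₁ → differ (cong (λ a → c a s) (sym a₂≡a₁)))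

  -- A fork costs 2 + 2; otherwise many-bound applies.
  lower-bound-4 : 5 ≤ m → 4 ≤ recoloured c + q
  lower-bound-4 5≤m with fork-or-many
  ... | inj₁ fork = +-mono-≤ (fork-two c fork) (fork-colours c bounded fork)
  ... | inj₂ many = ≤-trans (n≤1+n 4) (many-bound 5≤m many)

  -- For n ≥ 4 a fork costs 3 + 2.
  lower-bound-5 : 5 ≤ m → 4 ≤ n → 5 ≤ recoloured c + q
  lower-bound-5 5≤m 4≤n with fork-or-many
  ... | inj₁ fork = +-mono-≤ (fork-three 4≤n fork) (fork-colours c bounded fork)
  ... | inj₂ many = many-bound 5≤m many

Joined : ∀ {m n} → Colouring m n → Vertex m n → Vertex m n → Set
Joined c x y = ∃[ mid ] ProperPath c (x ∷ mid ++ [ y ])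

module Paths {m n} (c : Colouring m n) where

  edge-path : ∀ {x y : Vertex m n} → x ≢ y → Adj x y → Joined c x y
  edge-path x≢y xy = [] , ((x≢y ∷ []) ∷ [] ∷ []) , (xy ∷ [-]) , tt

  path₂ : ∀ {x z : Vertex m n} (y : Vertex m n) → x ≢ y → x ≢ z → y ≢ z → Adj x y → Adj y z →
    ecol c x y ≢ ecol c y z → Joined c x z
  path₂ y x≢y x≢z y≢z xy yz proper =
    [ y ] , ((x≢y ∷ x≢z ∷ []) ∷ (y≢z ∷ []) ∷ [] ∷ []) , (xy ∷ yz ∷ [-]) , proper , tt

  path₄ : ∀ {x₀ x₄ : Vertex m n} (x₁ x₂ x₃ : Vertex m n) →
    x₀ ≢ x₁ → x₀ ≢ x₂ → x₀ ≢ x₃ → x₀ ≢ x₄ → x₁ ≢ x₂ → x₁ ≢ x₃ → x₁ ≢ x₄ → x₂ ≢ x₃ → x₂ ≢ x₄ → x₃ ≢ x₄ →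
    Adj x₀ x₁ → Adj x₁ x₂ → Adj x₂ x₃ → Adj x₃ x₄ →
    ecol c x₀ x₁ ≢ ecol c x₁ x₂ → ecol c x₁ x₂ ≢ ecol c x₂ x₃ → ecol c x₂ x₃ ≢ ecol c x₃ x₄ →
    Joined c x₀ x₄
  path₄ x₁ x₂ x₃ d₀₁ d₀₂ d₀₃ d₀₄ d₁₂ d₁₃ d₁₄ d₂₃ d₂₄ d₃₄ a₀₁ a₁₂ a₂₃ a₃₄ p₁ p₂ p₃ =
    x₁ ∷ x₂ ∷ [ x₃ ] ,
    ((d₀₁ ∷ d₀₂ ∷ d₀₃ ∷ d₀₄ ∷ []) ∷ (d₁₂ ∷ d₁₃ ∷ d₁₄ ∷ []) ∷ (d₂₃ ∷ d₂₄ ∷ []) ∷ (d₃₄ ∷ []) ∷ [] ∷ []) ,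
    (a₀₁ ∷ a₁₂ ∷ a₂₃ ∷ a₃₄ ∷ [-]) , p₁ , p₂ , p₃ , tt

  connected-from : (∀ a a' → a ≢ a' → Joined c (inj₁ a) (inj₁ a')) →
                   (∀ b b' → b ≢ b' → Joined c (inj₂ b) (inj₂ b')) → ProperlyConnected c
  connected-from A-pairs B-pairs (inj₁ a) (inj₁ a') a≢a' = A-pairs a a' (a≢a' ∘ cong inj₁)
  connected-from A-pairs B-pairs (inj₂ b) (inj₂ b') b≢b' = B-pairs b b' (b≢b' ∘ cong inj₂)
  connected-from A-pairs B-pairs (inj₁ a) (inj₂ b)  a≢b  = edge-path a≢b tt
  connected-from A-pairs B-pairs (inj₂ b) (inj₁ a)  b≢a  = edge-path b≢a tt

open Paths

via-a₀ : ∀ {m n} (c : Colouring (suc m) n) {b b'} → b ≢ b' → c zero b ≢ c zero b' →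
  Joined c (inj₂ b) (inj₂ b')
via-a₀ c b≢b' differ = path₂ c (inj₁ zero) (λ ()) (b≢b' ∘ inj₂-injective) (λ ()) tt tt differ

-- A-vertices are pairwise joined in any colouring with a₀b₀ ↦ 1, a₀b₁ ↦ 2,
-- colour 0 on the rest of column b₀ and no colour 2 on the rest of column b₁:
-- a₀ reaches aᵢ by a₀ b₀ aᵢ, and aᵢ reaches aⱼ by aᵢ b₀ a₀ b₁ aⱼ.
A-pairs : ∀ {m n} (c : Colouring (suc m) (2 + n)) →
  c zero zero ≡ 1 → c zero (suc zero) ≡ 2 →
  (∀ i → c (suc i) zero ≡ 0) → (∀ i → c (suc i) (suc zero) ≢ 2) →
  ∀ a a' → a ≢ a' → Joined c (inj₁ a) (inj₁ a')
A-pairs c a₀b₀ a₀b₁ column₀ column₁ zero zero a≢a' = ⊥-elim (a≢a' refl)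
A-pairs c a₀b₀ a₀b₁ column₀ column₁ zero (suc i) _ =
  path₂ c (inj₂ zero) (λ ()) (λ ()) (λ ()) tt tt (subst₂ _≢_ (sym a₀b₀) (sym (column₀ i)) λ ())
A-pairs c a₀b₀ a₀b₁ column₀ column₁ (suc i) zero _ =
  path₂ c (inj₂ zero) (λ ()) (λ ()) (λ ()) tt tt (subst₂ _≢_ (sym (column₀ i)) (sym a₀b₀) λ ())
A-pairs c a₀b₀ a₀b₁ column₀ column₁ (suc i) (suc i') a≢a' =
  path₄ c (inj₂ zero) (inj₁ zero) (inj₂ (suc zero))
    (λ ()) (λ ()) (λ ()) (a≢a' ∘ inj₁-injective) (λ ()) (λ ()) (λ ()) (λ ()) (λ ()) (λ ())
    tt tt tt tt
    (subst₂ _≢_ (sym (column₀ i)) (sym a₀b₀) λ ())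
    (subst₂ _≢_ (sym a₀b₀) (sym a₀b₁) λ ())
    (λ two≡c → column₁ i' (trans (sym two≡c) a₀b₁))

uses-two-colours : ∀ {m n} (c : Colouring (suc m) (2 + n)) →
  c zero zero ≡ 1 → c zero (suc zero) ≡ 2 → (∀ i j → c i j ≤ 2) → UsesColours c 2
uses-two-colours c a₀b₀ a₀b₁ bounded = bounded , hit
  where
  hit : ∀ k → 1 ≤ k → k ≤ 2 → ∃[ i ] ∃[ j ] c i j ≡ k
  hit (suc zero)          _ _                  = zero , zero , a₀b₀
  hit (suc (suc zero))    _ _                  = zero , suc zero , a₀b₁
  hit (suc (suc (suc _))) _ (s≤s (s≤s ()))

colouring₂ : ∀ {m n} → Colouring (2 + m) (2 + n)
colouring₂ zero zero       = 1
colouring₂ zero (suc zero) = 2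
colouring₂ _    _          = 0

fin-subsingleton : ∀ {k} → k ≤ 1 → (i j : Fin k) → i ≡ j
fin-subsingleton {suc zero}    _             zero zero = refl
fin-subsingleton {suc (suc _)} (s≤s ()) _ _

-- With at most three columns, a₀ sees every B-vertex in a different colour.
B-pairs₂ : ∀ {m n} → n ≤ 1 → ∀ b b' → b ≢ b' → Joined (colouring₂ {m} {n}) (inj₂ b) (inj₂ b')
B-pairs₂ _   zero             zero             b≢b' = ⊥-elim (b≢b' refl)
B-pairs₂ _   (suc zero)       (suc zero)       b≢b' = ⊥-elim (b≢b' refl)
B-pairs₂ n≤1 (suc (suc j))    (suc (suc j'))   b≢b' = ⊥-elim (b≢b' (cong (λ k → suc (suc k)) (fin-subsingleton n≤1 j j')))
B-pairs₂ _   zero             (suc zero)       b≢b' = via-a₀ colouring₂ b≢b' λ ()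
B-pairs₂ _   zero             (suc (suc _))    b≢b' = via-a₀ colouring₂ b≢b' λ ()
B-pairs₂ _   (suc zero)       zero             b≢b' = via-a₀ colouring₂ b≢b' λ ()
B-pairs₂ _   (suc zero)       (suc (suc _))    b≢b' = via-a₀ colouring₂ b≢b' λ ()
B-pairs₂ _   (suc (suc _))    zero             b≢b' = via-a₀ colouring₂ b≢b' λ ()
B-pairs₂ _   (suc (suc _))    (suc zero)       b≢b' = via-a₀ colouring₂ b≢b' λ ()

feasible₂ : ∀ {m n} → 2 ≤ m → 2 ≤ n → n ≤ 3 → Feasible m n 2 2
feasible₂ {suc (suc m)} {suc (suc n)} (s≤s (s≤s _)) (s≤s (s≤s _)) (s≤s (s≤s n≤1)) =
  colouring₂ , recoloured₂ , uses-two-colours colouring₂ refl refl bounded ,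
  connected-from colouring₂ (A-pairs colouring₂ refl refl (λ _ → refl) (λ _ ()))
                            (B-pairs₂ n≤1)
  where
  recoloured₂ : recoloured (colouring₂ {m} {n}) ≡ 2
  recoloured₂ = trans (recoloured≡rows c)
    (cong₂ _+_ (cong (2 +_) (Σt-zero (λ j → nz (c zero (suc (suc j)))) λ _ → refl))
               (Σt-zero (rowCount c ∘ suc) λ i → Σt-zero (nz ∘ c (suc i)) λ _ → refl))
    where
    c : Colouring (2 + m) (2 + n)
    c = colouring₂
  bounded : ∀ i j → colouring₂ {m} {n} i j ≤ 2
  bounded zero    zero          = s≤s z≤n
  bounded zero    (suc zero)    = s≤s (s≤s z≤n)
  bounded zero    (suc (suc _)) = z≤n
  bounded (suc _) _             = z≤n

colouring₃ : ∀ {m n} → Colouring (2 + m) (2 + n)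
colouring₃ zero       zero       = 1
colouring₃ zero       (suc zero) = 2
colouring₃ (suc zero) (suc zero) = 1
colouring₃ _          _          = 0

-- B-vertices seen from a₀ in colour 0 are joined by b a₀ b₁ a₁ b'; the others through a₀.
B-pairs₃ : ∀ {m n} b b' → b ≢ b' → Joined (colouring₃ {m} {n}) (inj₂ b) (inj₂ b')
B-pairs₃ zero          zero          b≢b' = ⊥-elim (b≢b' refl)
B-pairs₃ (suc zero)    (suc zero)    b≢b' = ⊥-elim (b≢b' refl)
B-pairs₃ (suc (suc j)) (suc (suc j')) b≢b' =
  path₄ colouring₃ (inj₁ zero) (inj₂ (suc zero)) (inj₁ (suc zero))
    (λ ()) (λ ()) (λ ()) (b≢b' ∘ inj₂-injective) (λ ()) (λ ()) (λ ()) (λ ()) (λ ()) (λ ())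
    tt tt tt tt (λ ()) (λ ()) (λ ())
B-pairs₃ zero          (suc zero)    b≢b' = via-a₀ colouring₃ b≢b' λ ()
B-pairs₃ zero          (suc (suc _)) b≢b' = via-a₀ colouring₃ b≢b' λ ()
B-pairs₃ (suc zero)    zero          b≢b' = via-a₀ colouring₃ b≢b' λ ()
B-pairs₃ (suc zero)    (suc (suc _)) b≢b' = via-a₀ colouring₃ b≢b' λ ()
B-pairs₃ (suc (suc _)) zero          b≢b' = via-a₀ colouring₃ b≢b' λ ()
B-pairs₃ (suc (suc _)) (suc zero)    b≢b' = via-a₀ colouring₃ b≢b' λ ()

feasible₃ : ∀ {m n} → 2 ≤ m → 2 ≤ n → Feasible m n 3 2
feasible₃ {suc (suc m)} {suc (suc n)} (s≤s (s≤s _)) (s≤s (s≤s _)) =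
  colouring₃ , recoloured₃ , uses-two-colours colouring₃ refl refl bounded ,
  connected-from colouring₃ (A-pairs colouring₃ refl refl column₀ column₁) B-pairs₃
  where
  c : Colouring (2 + m) (2 + n)
  c = colouring₃
  recoloured₃ : recoloured c ≡ 3
  recoloured₃ = trans (recoloured≡rows c)
    (cong₂ _+_ (cong (2 +_) (Σt-zero (λ j → nz (c zero (suc (suc j)))) λ _ → refl))
      (cong₂ _+_ (cong (1 +_) (Σt-zero (λ j → nz (c (suc zero) (suc (suc j)))) λ _ → refl))
                 (Σt-zero (λ i → rowCount c (suc (suc i))) λ i → Σt-zero (nz ∘ c (suc (suc i))) λ _ → refl)))
  bounded : ∀ i j → c i j ≤ 2
  bounded zero          zero          = s≤s z≤n
  bounded zero          (suc zero)    = s≤s (s≤s z≤n)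
  bounded zero          (suc (suc _)) = z≤n
  bounded (suc zero)    zero          = z≤n
  bounded (suc zero)    (suc zero)    = s≤s z≤n
  bounded (suc zero)    (suc (suc _)) = z≤n
  bounded (suc (suc _)) _             = z≤n
  column₀ : ∀ i → c (suc i) zero ≡ 0
  column₀ zero    = refl
  column₀ (suc _) = refl
  column₁ : ∀ i → c (suc i) (suc zero) ≢ 2
  column₁ zero    ()
  column₁ (suc _) ()

optimal : ∀ {m n p q} → Feasible m n p q → (∀ p' q' → Feasible m n p' q' → p + q ≤ p' + q') →
  OptimalFeasible m n p q
optimal {p = p} {q} feasible lower = feasible , (p , q , feasible , refl) , lower

feasible-lower-4 : ∀ {m n} → 5 ≤ m → ∀ p q → Feasible m n p q → 4 ≤ p + q
feasible-lower-4 5≤m p q (c , refl , (bounded , _) , connected) =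
  LowerBound.lower-bound-4 c q bounded connected 5≤m

feasible-lower-5 : ∀ {m n} → 5 ≤ m → 4 ≤ n → ∀ p q → Feasible m n p q → 5 ≤ p + q
feasible-lower-5 5≤m 4≤n p q (c , refl , (bounded , _) , connected) =
  LowerBound.lower-bound-5 c q bounded connected 5≤m 4≤n

five≤m : ∀ {m n} → n ≤ m → 9 ≤ m + n → 5 ≤ m
five≤m {m} n≤m 9≤m+n with 5 ≤? m
... | yes 5≤m = 5≤m
... | no  5≰m = contradiction (≤-trans 9≤m+n (+-mono-≤ m≤4 (≤-trans n≤m m≤4))) 1+n≰n
  where
  m≤4 : m ≤ 4
  m≤4 = ≤-pred (≰⇒> 5≰m)

theorem14 : (m n : ℕ) → n ≤ m → 2 ≤ n → 9 ≤ m + n →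
    ((n ≡ 2 ⊎ n ≡ 3) → OptimalFeasible m n 2 2) ×
    (4 ≤ n → OptimalFeasible m n 3 2)
theorem14 m n n≤m 2≤n 9≤m+n = small , large
  where
  5≤m : 5 ≤ m
  5≤m = five≤m n≤m 9≤m+n
  2≤m : 2 ≤ m
  2≤m = ≤-trans 2≤n n≤m
  small : (n ≡ 2 ⊎ n ≡ 3) → OptimalFeasible m n 2 2
  small (inj₁ refl) = optimal (feasible₂ 2≤m 2≤n (n≤1+n 2)) (feasible-lower-4 5≤m)
  small (inj₂ refl) = optimal (feasible₂ 2≤m 2≤n ≤-refl) (feasible-lower-4 5≤m)
  large : 4 ≤ n → OptimalFeasible m n 3 2
  large 4≤n = optimal (feasible₃ 2≤m 2≤n) (feasible-lower-5 5≤m 4≤n)
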